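{- Fix an integer base $B\ge 2$. For every integer $k > 0$ there are infinitely many positive integers $n$ with $h(n) \le -k$.
   Context: For a positive integer $n$, $\delta(n)$ is the number of base-$B$ digits of $n$, i.e. $\delta(n)=k$ iff $B^{k-1}\le n<B^k$. Define $\delta'(a)=\delta(a)$ for $a>1$ and $\delta'(1)=0$. If $n=\prod_{i=1}^r p_i^{a_i}$ is the prime power factorisation of $n$, put $\phi(n)=\sum_{i} \big(\delta(p_i)+\delta'(a_i)\big)$ (so $\phi(1)=0$) and $h(n)=\delta(n)-\phi(n)$. -}

module Defs where

open import Data.Nat using (ℕ; zero; suc; _+_; _/_; _<?_)
open import Data.Nat.Divisibility using (_∣?_)
open import Data.Nat.Primality using (prime?)
open import Data.List using (upTo; map)
open import Data.Nat.ListAction using (sum)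
open import Data.Integer using (ℤ; +_; _-_)
open import Relation.Nullary using (yes; no)
open import Relation.Nullary.Decidable using (_×-dec_)

-- digitsF fuel B n : number of base-B digits of n (repeatedly divide by B
-- until n < B), with structural fuel.  Only meaningful for B ≥ 2, n ≥ 1,
-- fuel ≥ δ(n) (fuel = n always suffices).
digitsF : ℕ → ℕ → ℕ → ℕ
digitsF zero    B       n = 0
digitsF (suc f) zero    n = 0
digitsF (suc f) (suc b) n with n <? suc b
... | yes _ = 1
... | no  _ = suc (digitsF f (suc b) (n / suc b))

-- δ B n = k  iff  B^(k-1) ≤ n < B^k   (for n ≥ 1, B ≥ 2)
δ : ℕ → ℕ → ℕ
δ B n = digitsF n B n

δ' : ℕ → ℕ → ℕ
δ' B (suc zero) = 0
δ' B a          = δ B a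

-- multiplicity of p in n (exponent of p in the prime factorisation of n),
-- with fuel; meaningful for p ≥ 2, n ≥ 1 (fuel = n suffices).
valF : ℕ → ℕ → ℕ → ℕ
valF zero    p       n = 0
valF (suc f) zero    n = 0
valF (suc f) (suc q) n with suc q ∣? n
... | yes _ = suc (valF f (suc q) (n / suc q))
... | no  _ = 0

val : ℕ → ℕ → ℕ
val p n = valF n p n

term : ℕ → ℕ → ℕ → ℕ
term B n p with prime? p ×-dec (p ∣? n)
... | yes _ = δ B p + δ' B (val p n)
... | no  _ = 0

-- φ(n) = Σ over prime factors p^a of n of (δ(p) + δ'(a)); primes dividing
-- n ≥ 1 are all ≤ n, so summing over p ∈ {0,…,n} covers them.  φ(1) = 0.
φ : ℕ → ℕ → ℕ
φ B n = sum (map (term B n) (upTo (suc n)))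

h : ℕ → ℕ → ℤ
h B n = + δ B n - + φ B n

-- Take n to be the product of the primes below L.  All its exponents are 1, so
-- φ(n) = Σ_{p<L} δ(p), and p + 1 ≤ B^δ(p) gives ∏_{p<L} (p + 1) ≤ B^φ(n).  Since δ(n)
-- is the least d with n < B^d, h(n) ≤ -K as soon as B^K · ∏ p < ∏ (p + 1), that is
-- ∏_{p<L} (1 + 1/p) > B^K.  This product is unbounded by Erdős's counting argument:
-- if X = 2^E and (E + 1)^π(N) ≤ X/2, at most half of 1, …, X are products ∏ q^{i_q}
-- of primes q < N (all i_q ≤ E), so the other half have a prime factor N ≤ p ≤ X,
-- whence Σ_{N≤p≤X} ⌊X/p⌋ ≥ X/2 and ∏_{N≤p≤X} (1 + 1/p) ≥ 3/2.

module Submission where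

open import Defs
open import Data.Nat using (ℕ; _≤_; _<_)
open import Data.Integer using (+_; -_) renaming (_≤_ to _≤ℤ_)
open import Data.Product using (∃-syntax; _×_)

open import Data.Bool using (if_then_else_)
open import Data.Integer using (_⊖_; +≤+)
import Data.Integer.Properties as ℤ
open import Data.List using (List; []; _∷_; map; upTo; length; filter; cartesianProductWith; _++_; [_])
open import Data.List.Membership.Propositional using (_∈_)
open import Data.List.Membership.Propositional.Properties using (∈-cartesianProductWith⁺; ∈-upTo⁺; ∈-filter⁺)
open import Data.List.Properties using (map-++; upTo-∷ʳ; length-++; length-map; length-upTo)
open import Data.List.Relation.Unary.All using (All; []; _∷_)
open import Data.List.Relation.Unary.All.Properties using (all-filter)
open import Data.List.Relation.Unary.Any using (here; there)
open import Data.Nat using (zero; suc; _+_; _*_; _∸_; _^_; _/_; _%_; _<?_; _≤?_; _≟_; z≤n; s≤s; z<s)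
open import Data.Nat using (NonZero; >-nonZero; nonTrivial⇒n>1)
open import Data.Nat.DivMod using (m≡m%n+[m/n]*n; m%n<n; m≥n⇒m/n>0; m/n<m; m<n*o⇒m/o<n)
open import Data.Nat.Divisibility using (_∣_; _∣?_; ∣⇒≤; divides; m∣m*n; ∣m+n∣m⇒∣n; ∣n⇒∣m*n; ∣m⇒∣m*n; ∣-refl)
open import Data.Nat.Induction using (<-wellFounded)
open import Data.Nat.ListAction using (sum; product)
open import Data.Nat.ListAction.Properties using (sum-++)
open import Data.Nat.Primality using (Prime; prime?; prime⇒nonTrivial)
open import Data.Nat.Primality.Factorisation using (factorise)
open import Data.Nat.Properties
open import Algebra.Properties.CommutativeSemigroup +-commutativeSemigroup
  using () renaming (interchange to +-interchange)
open import Algebra.Properties.CommutativeSemigroup *-commutativeSemigroup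
  using (x∙yz≈y∙xz) renaming (interchange to *-interchange)
open import Data.Nat.Tactic.RingSolver using (solve-∀)
open import Data.Product using (_,_)
open import Data.Sum using (inj₁; inj₂)
open import Function using (_∘_; id)
open import Induction.WellFounded using (Acc; acc)
open import Relation.Binary.PropositionalEquality hiding ([_])
open import Relation.Nullary using (Dec; yes; no; does; ¬_; contradiction)
open import Relation.Nullary.Decidable using (_×-dec_)

private
  variable
    d n : ℕ
    f g : ℕ → ℕ

∑< : ℕ → (ℕ → ℕ) → ℕ
∑< zero    f = 0
∑< (suc d) f = ∑< d f + f d

∏< : ℕ → (ℕ → ℕ) → ℕ
∏< zero    f = 1
∏< (suc d) f = ∏< d f * f d

syntax ∑< d (λ i → x) = ∑[ i < d ] x
syntax ∏< d (λ i → x) = ∏[ i < d ] x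

∑<-cong : ∀ d → (∀ i → f i ≡ g i) → ∑< d f ≡ ∑< d g
∑<-cong zero    f≗g = refl
∑<-cong (suc d) f≗g = cong₂ _+_ (∑<-cong d f≗g) (f≗g d)

∑<-monoʳ-≤ : ∀ d → (∀ i → i < d → f i ≤ g i) → ∑< d f ≤ ∑< d g
∑<-monoʳ-≤ zero    f≤g = z≤n
∑<-monoʳ-≤ (suc d) f≤g = +-mono-≤ (∑<-monoʳ-≤ d (λ i i<d → f≤g i (m<n⇒m<1+n i<d))) (f≤g d ≤-refl)

∑<-distrib-+ : ∀ d f g → ∑[ i < d ] (f i + g i) ≡ ∑< d f + ∑< d g
∑<-distrib-+ zero    f g = refl
∑<-distrib-+ (suc d) f g =
  trans (cong (_+ (f d + g d)) (∑<-distrib-+ d f g)) (+-interchange (∑< d f) (∑< d g) (f d) (g d))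

∑<-zero : ∀ d → ∑[ i < d ] 0 ≡ 0
∑<-zero zero    = refl
∑<-zero (suc d) = cong (_+ 0) (∑<-zero d)

∑<-comm : ∀ m n (h : ℕ → ℕ → ℕ) → ∑[ i < m ] ∑[ j < n ] h i j ≡ ∑[ j < n ] ∑[ i < m ] h i j
∑<-comm zero    n h = sym (∑<-zero n)
∑<-comm (suc m) n h = begin
  ∑[ i < m ] ∑[ j < n ] h i j + ∑[ j < n ] h m j   ≡⟨ cong (_+ ∑[ j < n ] h m j) (∑<-comm m n h) ⟩
  ∑[ j < n ] ∑[ i < m ] h i j + ∑[ j < n ] h m j   ≡⟨ ∑<-distrib-+ n (λ j → ∑[ i < m ] h i j) (h m) ⟨
  ∑[ j < n ] ∑[ i < suc m ] h i j                  ∎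
  where open ≡-Reasoning

∑<-const : ∀ d c → ∑[ i < d ] c ≡ d * c
∑<-const zero    c = refl
∑<-const (suc d) c = trans (cong (_+ c) (∑<-const d c)) (+-comm (d * c) c)

≤-∑< : ∀ {i} d → i < d → f i ≤ ∑< d f
≤-∑< {f} {i} (suc d) i<1+d with m≤n⇒m<n∨m≡n (≤-pred i<1+d)
... | inj₁ i<d  = ≤-trans (≤-∑< d i<d) (m≤m+n (∑< d f) (f d))
... | inj₂ refl = m≤n+m (f i) (∑< d f)

∑<-monoˡ-≤ : d ≤ n → ∑< d f ≤ ∑< n f
∑<-monoˡ-≤ {n = zero}  z≤n = z≤n
∑<-monoˡ-≤ {d} {suc n} {f} d≤1+n with m≤n⇒m<n∨m≡n d≤1+n
... | inj₁ d<1+n = ≤-trans (∑<-monoˡ-≤ (≤-pred d<1+n)) (m≤m+n (∑< n f) (f n))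
... | inj₂ refl  = ≤-refl

∑<-≤-of-vanishing : ∀ d n → (∀ i → n ≤ i → f i ≡ 0) → ∑< d f ≤ ∑< n f
∑<-≤-of-vanishing zero    n f≡0 = z≤n
∑<-≤-of-vanishing {f} (suc d) n f≡0 with d <? n
... | yes d<n = ∑<-monoˡ-≤ d<n
... | no  d≮n = begin
  ∑< d f + f d ≡⟨ cong (λ x → ∑< d f + x) (f≡0 d (≮⇒≥ d≮n)) ⟩
  ∑< d f + 0   ≡⟨ +-identityʳ (∑< d f) ⟩
  ∑< d f       ≤⟨ ∑<-≤-of-vanishing d n f≡0 ⟩
  ∑< n f       ∎
  where open ≤-Reasoning

∏<-cong : ∀ d → (∀ i → f i ≡ g i) → ∏< d f ≡ ∏< d g
∏<-cong zero    f≗g = refl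
∏<-cong (suc d) f≗g = cong₂ _*_ (∏<-cong d f≗g) (f≗g d)

∏<-monoʳ-≤ : ∀ d → (∀ i → f i ≤ g i) → ∏< d f ≤ ∏< d g
∏<-monoʳ-≤ zero    f≤g = ≤-refl
∏<-monoʳ-≤ (suc d) f≤g = *-mono-≤ (∏<-monoʳ-≤ d f≤g) (f≤g d)

∏<-distrib-* : ∀ d f g → ∏[ i < d ] (f i * g i) ≡ ∏< d f * ∏< d g
∏<-distrib-* zero    f g = refl
∏<-distrib-* (suc d) f g =
  trans (cong (_* (f d * g d)) (∏<-distrib-* d f g)) (*-interchange (∏< d f) (∏< d g) (f d) (g d))

∏<-^ : ∀ d c f → ∏[ i < d ] (c ^ f i) ≡ c ^ ∑< d f
∏<-^ zero    c f = refl
∏<-^ (suc d) c f = trans (cong (_* c ^ f d) (∏<-^ d c f)) (sym (^-distribˡ-+-* c (∑< d f) (f d)))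

∏<-+ : ∀ d e f → ∏< (d + e) f ≡ ∏< d f * ∏[ i < e ] f (d + i)
∏<-+ d zero    f = trans (cong (λ k → ∏< k f) (+-identityʳ d)) (sym (*-identityʳ (∏< d f)))
∏<-+ d (suc e) f = begin
  ∏< (d + suc e) f                                  ≡⟨ cong (λ k → ∏< k f) (+-suc d e) ⟩
  ∏< (d + e) f * f (d + e)                          ≡⟨ cong (_* f (d + e)) (∏<-+ d e f) ⟩
  ∏< d f * ∏[ i < e ] f (d + i) * f (d + e)         ≡⟨ *-assoc (∏< d f) _ (f (d + e)) ⟩
  ∏< d f * ∏[ i < suc e ] f (d + i)                 ∎
  where open ≡-Reasoning

sum-map-upTo : ∀ n f → sum (map f (upTo n)) ≡ ∑< n f
sum-map-upTo zero    f = refl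
sum-map-upTo (suc n) f = begin
  sum (map f (upTo (suc n)))        ≡⟨ cong (sum ∘ map f) (upTo-∷ʳ n) ⟨
  sum (map f (upTo n ++ [ n ]))     ≡⟨ cong sum (map-++ f (upTo n) [ n ]) ⟩
  sum (map f (upTo n) ++ [ f n ])   ≡⟨ sum-++ (map f (upTo n)) [ f n ] ⟩
  sum (map f (upTo n)) + (f n + 0)  ≡⟨ cong₂ _+_ (sum-map-upTo n f) (+-identityʳ (f n)) ⟩
  ∑< (suc n) f                      ∎
  where open ≡-Reasoning

m<n*[1+m/n] : ∀ m n .{{_ : NonZero n}} → m < n * suc (m / n)
m<n*[1+m/n] m n = begin-strict
  m                     ≡⟨ m≡m%n+[m/n]*n m n ⟩
  m % n + m / n * n     <⟨ +-monoˡ-< (m / n * n) (m%n<n m n) ⟩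
  n + m / n * n         ≡⟨ *-comm (suc (m / n)) n ⟩
  n * suc (m / n)       ∎
  where open ≤-Reasoning

n<b^n : ∀ {b} → 1 < b → ∀ n → n < b ^ n
n<b^n 1<b zero    = s≤s z≤n
n<b^n {b} 1<b (suc n) = ≤-<-trans (n<b^n 1<b n) (^-monoʳ-< b 1<b (n<1+n n))

^-cancelʳ-≤ : ∀ {b m n} → 1 < b → b ^ m ≤ b ^ n → m ≤ n
^-cancelʳ-≤ {b} {m} {n} 1<b b^m≤b^n with m ≤? n
... | yes m≤n = m≤n
... | no  m≰n = contradiction b^m≤b^n (<⇒≱ (^-monoʳ-< b 1<b (≰⇒> m≰n)))

n<B^digitsF : ∀ {B} → 1 < B → ∀ fuel {n} → 0 < n → n ≤ fuel → n < B ^ digitsF fuel B n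
n<B^digitsF           1<B zero       0<n n≤0    = contradiction n≤0 (<⇒≱ 0<n)
n<B^digitsF {B@(suc _)} 1<B (suc fuel) {n} 0<n n≤1+fuel with n <? B
... | yes n<B = subst (n <_) (sym (*-identityʳ B)) n<B
... | no  n≮B = begin-strict
  n                             <⟨ m<n*[1+m/n] n B ⟩
  B * suc (n / B)               ≤⟨ *-monoʳ-≤ B (n<B^digitsF 1<B fuel (m≥n⇒m/n>0 (≮⇒≥ n≮B)) n/B≤fuel) ⟩
  B * B ^ digitsF fuel B (n / B) ∎
  where
  open ≤-Reasoning
  n/B≤fuel : n / B ≤ fuel
  n/B≤fuel = ≤-pred (≤-trans (m/n<m n B {{>-nonZero 0<n}} 1<B) n≤1+fuel)

digitsF-least : ∀ {B} → 1 < B → ∀ fuel {n} k → 0 < n → n ≤ fuel → n < B ^ k → digitsF fuel B n ≤ k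
digitsF-least           1<B zero       k       0<n n≤0 n<B^k = z≤n
digitsF-least           1<B (suc fuel) zero    0<n n≤1+fuel n<1 = contradiction 0<n (<⇒≱ n<1)
digitsF-least {B@(suc _)} 1<B (suc fuel) {n} (suc k) 0<n n≤1+fuel n<B^1+k with n <? B
... | yes n<B = s≤s z≤n
... | no  n≮B = s≤s (digitsF-least 1<B fuel k (m≥n⇒m/n>0 (≮⇒≥ n≮B)) n/B≤fuel n/B<B^k)
  where
  n/B≤fuel : n / B ≤ fuel
  n/B≤fuel = ≤-pred (≤-trans (m/n<m n B {{>-nonZero 0<n}} 1<B) n≤1+fuel)
  n/B<B^k : n / B < B ^ k
  n/B<B^k = m<n*o⇒m/o<n (subst (n <_) (*-comm B (B ^ k)) n<B^1+k)

n<B^δ : ∀ {B n} → 1 < B → 0 < n → n < B ^ δ B n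
n<B^δ 1<B 0<n = n<B^digitsF 1<B _ 0<n ≤-refl

δ-least : ∀ {B n} k → 1 < B → 0 < n → n < B ^ k → δ B n ≤ k
δ-least k 1<B 0<n = digitsF-least 1<B _ k 0<n ≤-refl

prime⇒1<p : ∀ {p} → Prime p → 1 < p
prime⇒1<p {p} pr = nonTrivial⇒n>1 p {{prime⇒nonTrivial pr}}

onPrime : ℕ → (ℕ → ℕ) → ℕ → ℕ
onPrime e f p = if does (prime? p) then f p else e

∑ₚ : (ℕ → ℕ) → ℕ → ℕ → ℕ
∑ₚ f N d = ∑[ i < d ] onPrime 0 f (N + i)

∏ₚ : (ℕ → ℕ) → ℕ → ℕ → ℕ
∏ₚ f N d = ∏[ i < d ] onPrime 1 f (N + i)

∏ₚ-+ : ∀ f N d e → ∏ₚ f N (d + e) ≡ ∏ₚ f N d * ∏ₚ f (N + d) e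
∏ₚ-+ f N d e = trans (∏<-+ d e (λ i → onPrime 1 f (N + i)))
  (cong (∏ₚ f N d *_) (∏<-cong e (λ i → cong (onPrime 1 f) (sym (+-assoc N d i)))))

1≤∏ₚ : ∀ N d → 1 ≤ ∏ₚ id N d
1≤∏ₚ N zero    = ≤-refl
1≤∏ₚ N (suc d) = *-mono-≤ (1≤∏ₚ N d) 1≤onPrime
  where
  1≤onPrime : 1 ≤ onPrime 1 id (N + d)
  1≤onPrime with prime? (N + d)
  ... | yes pr = <⇒≤ (prime⇒1<p pr)
  ... | no  _  = ≤-refl

∏ₚ-ratio-+ : ∀ {a b c e} N d₁ d₂ →
  a * ∏ₚ id N d₁ ≤ b * ∏ₚ suc N d₁ → c * ∏ₚ id (N + d₁) d₂ ≤ e * ∏ₚ suc (N + d₁) d₂ →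
  a * c * ∏ₚ id N (d₁ + d₂) ≤ b * e * ∏ₚ suc N (d₁ + d₂)
∏ₚ-ratio-+ {a} {b} {c} {e} N d₁ d₂ aA₁≤bQ₁ cA₂≤eQ₂ = begin
  a * c * ∏ₚ id N (d₁ + d₂)   ≡⟨ cong (a * c *_) (∏ₚ-+ id N d₁ d₂) ⟩
  a * c * (A₁ * A₂)           ≡⟨ *-interchange a c A₁ A₂ ⟩
  a * A₁ * (c * A₂)           ≤⟨ *-mono-≤ aA₁≤bQ₁ cA₂≤eQ₂ ⟩
  b * Q₁ * (e * Q₂)           ≡⟨ *-interchange b Q₁ e Q₂ ⟩
  b * e * (Q₁ * Q₂)           ≡⟨ cong (b * e *_) (∏ₚ-+ suc N d₁ d₂) ⟨
  b * e * ∏ₚ suc N (d₁ + d₂)  ∎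
  where
  open ≤-Reasoning
  A₁ = ∏ₚ id N d₁
  A₂ = ∏ₚ id (N + d₁) d₂
  Q₁ = ∏ₚ suc N d₁
  Q₂ = ∏ₚ suc (N + d₁) d₂

onPrime-δ≤term : ∀ B n p → (Prime p → p ∣ n) → onPrime 0 (δ B) p ≤ term B n p
onPrime-δ≤term B n p p∣n with prime? p | prime? p ×-dec (p ∣? n)
... | no  _  | _           = z≤n
... | yes _  | yes _       = m≤m+n (δ B p) _
... | yes pr | no ¬pr×p∣n  = contradiction (pr , p∣n pr) ¬pr×p∣n

term-∤ : ∀ B n p → ¬ p ∣ n → term B n p ≡ 0
term-∤ B n p p∤n with prime? p ×-dec (p ∣? n)
... | yes (_ , p∣n) = contradiction p∣n p∤n
... | no  _         = refl

∑ₚδ≤φ : ∀ B n L → 0 < n → (∀ p → p < L → Prime p → p ∣ n) → ∑ₚ (δ B) 0 L ≤ φ B n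
∑ₚδ≤φ B n L 0<n primes∣n = begin
  ∑ₚ (δ B) 0 L           ≤⟨ ∑<-monoʳ-≤ L (λ p p<L → onPrime-δ≤term B n p (primes∣n p p<L)) ⟩
  ∑< L (term B n)        ≤⟨ ∑<-≤-of-vanishing L (suc n) (λ p n<p → term-∤ B n p (n<p⇒p∤n n<p)) ⟩
  ∑< (suc n) (term B n)  ≡⟨ sum-map-upTo (suc n) (term B n) ⟨
  φ B n                  ∎
  where
  open ≤-Reasoning
  n<p⇒p∤n : ∀ {p} → n < p → ¬ p ∣ n
  n<p⇒p∤n n<p p∣n = <⇒≱ n<p (∣⇒≤ {{>-nonZero 0<n}} p∣n)

𝟙 : {A : Set} → Dec A → ℕ
𝟙 (yes _) = 1
𝟙 (no  _) = 0

multiples : ℕ → ℕ → ℕ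
multiples p X = ∑[ n < X ] 𝟙 (p ∣? suc n)

multiples-remainder : ∀ q X → ∃[ r ] (r ≤ q × suc q * multiples (suc q) X + r ≡ X)
multiples-remainder q zero = 0 , z≤n , trans (+-identityʳ (suc q * 0)) (*-zeroʳ (suc q))
multiples-remainder q (suc X) with multiples-remainder q X | suc q ∣? suc X
... | r , r≤q , eq | yes q+1∣1+X = 0 , z≤n , (begin
  suc q * (c + 1) + 0  ≡⟨ step q c ⟩
  suc (suc q * c + q)  ≡⟨ cong (λ s → suc (suc q * c + s)) r≡q ⟨
  suc (suc q * c + r)  ≡⟨ cong suc eq ⟩
  suc X                ∎)
  where
  open ≡-Reasoning
  c = multiples (suc q) X
  step : ∀ q c → suc q * (c + 1) + 0 ≡ suc (suc q * c + q)
  step = solve-∀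
  q+1∣1+r : suc q ∣ suc r
  q+1∣1+r = ∣m+n∣m⇒∣n (subst (suc q ∣_) (sym (trans (+-suc _ r) (cong suc eq))) q+1∣1+X) (m∣m*n c)
  r≡q : r ≡ q
  r≡q = ≤-antisym r≤q (≤-pred (∣⇒≤ q+1∣1+r))
... | r , r≤q , eq | no q+1∤1+X = suc r , r<q , trans (step q (multiples (suc q) X) r) (cong suc eq)
  where
  step : ∀ q c r → suc q * (c + 0) + suc r ≡ suc (suc q * c + r)
  step = solve-∀
  r<q : r < q
  r<q = ≤∧≢⇒< r≤q λ { refl →
    q+1∤1+X (divides (multiples (suc q) X + 1) (trans (cong suc (sym eq)) (shift r (multiples (suc q) X)))) }
    where
    shift : ∀ q c → suc (suc q * c + q) ≡ (c + 1) * suc q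
    shift = solve-∀

*-multiples≤ : ∀ {p} X → 0 < p → p * multiples p X ≤ X
*-multiples≤ {suc q} X _ with multiples-remainder q X
... | r , _ , eq = subst (suc q * multiples (suc q) X ≤_) eq (m≤m+n _ r)

-- 1 + Σ_p c p / X ≤ 1 + Σ_p 1/p ≤ ∏_p (1 + 1/p), multiplied through by X · ∏ p.
∏ₚ-weierstrass : ∀ X (c : ℕ → ℕ) N d → (∀ p → Prime p → p * c p ≤ X) →
  ∏ₚ id N d * (X + ∑ₚ c N d) ≤ X * ∏ₚ suc N d
∏ₚ-weierstrass X c N zero    _     = ≤-reflexive (trans (+-identityʳ (X + 0)) (sym (*-comm X 1)))
∏ₚ-weierstrass X c N (suc d) pc≤X with prime? (N + d)
... | no _ = begin
  A * 1 * (X + (S + 0)) ≡⟨ tidy A X S ⟩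
  A * (X + S)           ≤⟨ ∏ₚ-weierstrass X c N d pc≤X ⟩
  X * Q                 ≡⟨ cong (X *_) (*-identityʳ Q) ⟨
  X * (Q * 1)           ∎
  where
  open ≤-Reasoning
  A = ∏ₚ id N d
  S = ∑ₚ c N d
  Q = ∏ₚ suc N d
  tidy : ∀ a x s → a * 1 * (x + (s + 0)) ≡ a * (x + s)
  tidy = solve-∀
... | yes pr = begin
  A * p * (X + (S + c p))          ≡⟨ expand A p X S (c p) ⟩
  p * (A * (X + S)) + A * (p * c p) ≤⟨ +-monoʳ-≤ (p * (A * (X + S))) (*-monoʳ-≤ A (≤-trans (pc≤X p pr) (m≤m+n X S))) ⟩
  p * (A * (X + S)) + A * (X + S)   ≡⟨ +-comm (p * (A * (X + S))) (A * (X + S)) ⟩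
  suc p * (A * (X + S))             ≤⟨ *-monoʳ-≤ (suc p) (∏ₚ-weierstrass X c N d pc≤X) ⟩
  suc p * (X * Q)                   ≡⟨ shuffle (suc p) X Q ⟩
  X * (Q * suc p)                   ∎
  where
  open ≤-Reasoning
  p = N + d
  A = ∏ₚ id N d
  S = ∑ₚ c N d
  Q = ∏ₚ suc N d
  expand : ∀ a p x s c → a * p * (x + (s + c)) ≡ p * (a * (x + s)) + a * (p * c)
  expand = solve-∀
  shuffle : ∀ p x q → p * (x * q) ≡ x * (q * p)
  shuffle = solve-∀

multiplicity : ℕ → List ℕ → ℕ
multiplicity x []       = 0
multiplicity x (y ∷ ys) = 𝟙 (x ≟ y) + multiplicity x ys

∈⇒1≤multiplicity : ∀ {x ys} → x ∈ ys → 1 ≤ multiplicity x ys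
∈⇒1≤multiplicity {x} {y ∷ ys} (here refl) with x ≟ x
... | yes _   = s≤s z≤n
... | no  x≢x = contradiction refl x≢x
∈⇒1≤multiplicity {x} {y ∷ ys} (there x∈ys) = ≤-trans (∈⇒1≤multiplicity x∈ys) (m≤n+m _ (𝟙 (x ≟ y)))

∑-𝟙[1+n≟y]≤1 : ∀ X y → ∑[ n < X ] 𝟙 (suc n ≟ y) ≤ 1
∑-𝟙[1+n≟y]≤1 zero    y = z≤n
∑-𝟙[1+n≟y]≤1 (suc X) y with suc X ≟ y
... | yes refl = ≤-reflexive (cong (_+ 1) (vanish X ≤-refl))
  where
  vanish : ∀ Z → Z ≤ X → ∑[ n < Z ] 𝟙 (suc n ≟ suc X) ≡ 0
  vanish zero    _   = refl
  vanish (suc Z) Z<X with suc Z ≟ suc X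
  ... | yes refl = contradiction Z<X (n≮n X)
  ... | no  _    = trans (+-identityʳ _) (vanish Z (<⇒≤ Z<X))
... | no  _    = subst (_≤ 1) (sym (+-identityʳ _)) (∑-𝟙[1+n≟y]≤1 X y)

∑-multiplicity≤length : ∀ X ys → ∑[ n < X ] multiplicity (suc n) ys ≤ length ys
∑-multiplicity≤length X []       = ≤-reflexive (∑<-zero X)
∑-multiplicity≤length X (y ∷ ys) =
  subst (_≤ suc (length ys)) (sym (∑<-distrib-+ X _ _))
        (+-mono-≤ (∑-𝟙[1+n≟y]≤1 X y) (∑-multiplicity≤length X ys))

length-cartesianProductWith : ∀ {A B C : Set} (f : A → B → C) xs ys →
  length (cartesianProductWith f xs ys) ≡ length xs * length ys
length-cartesianProductWith f []       ys = refl
length-cartesianProductWith f (x ∷ xs) ys = trans (length-++ (map (f x) ys))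
  (cong₂ _+_ (length-map (f x) ys) (length-cartesianProductWith f xs ys))

monomials : ℕ → List ℕ → List ℕ
monomials E []       = [ 1 ]
monomials E (q ∷ qs) = cartesianProductWith (λ i m → q ^ i * m) (upTo (suc E)) (monomials E qs)

length-monomials : ∀ E qs → length (monomials E qs) ≡ suc E ^ length qs
length-monomials E []       = refl
length-monomials E (q ∷ qs) = begin
  length (monomials E (q ∷ qs))                   ≡⟨ length-cartesianProductWith _ (upTo (suc E)) (monomials E qs) ⟩
  length (upTo (suc E)) * length (monomials E qs) ≡⟨ cong₂ _*_ (length-upTo (suc E)) (length-monomials E qs) ⟩
  suc E ^ length (q ∷ qs)                         ∎
  where open ≡-Reasoning

power-split : ∀ {q} → 1 < q → ∀ {n} → 0 < n → ∃[ i ] ∃[ m ] (n ≡ q ^ i * m × ¬ q ∣ m × 0 < m)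
power-split {q} 1<q {n} = go (<-wellFounded n)
  where
  go : ∀ {n} → Acc _<_ n → 0 < n → ∃[ i ] ∃[ m ] (n ≡ q ^ i * m × ¬ q ∣ m × 0 < m)
  go {n} (acc rec) 0<n with q ∣? n
  ... | no  q∤n = 0 , n , sym (*-identityˡ n) , q∤n , 0<n
  ... | yes (divides k@(suc _) refl) with go (rec (m<m*n k q 1<q)) z<s
  ...   | i , m , k≡q^i*m , q∤m , 0<m =
    suc i , m , trans (cong (_* q) k≡q^i*m) (rearrange (q ^ i) m q) , q∤m , 0<m
    where
    rearrange : ∀ a m q → a * m * q ≡ q * a * m
    rearrange = solve-∀

no-prime-divisor⇒≡1 : ∀ {n} → 0 < n → (∀ {p} → Prime p → ¬ p ∣ n) → n ≡ 1
no-prime-divisor⇒≡1 {n} 0<n no-p∣n with factorise n {{>-nonZero 0<n}}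
... | record { factors = [] ; isFactorisation = n≡1 } = n≡1
... | record { factors = p ∷ ps ; isFactorisation = n≡p*ps ; factorsPrime = pr ∷ _ } =
  contradiction (divides (product ps) (trans n≡p*ps (*-comm p (product ps)))) (no-p∣n pr)

∈-monomials : ∀ E {qs n} → All Prime qs → 0 < n → n ≤ 2 ^ E →
              (∀ {r} → Prime r → r ∣ n → r ∈ qs) → n ∈ monomials E qs
∈-monomials E {[]} [] 0<n _ factors∈ =
  here (no-prime-divisor⇒≡1 0<n (λ pr r∣n → contradiction (factors∈ pr r∣n) λ ()))
∈-monomials E {q ∷ qs} (pr ∷ prs) 0<n n≤2^E factors∈ with power-split (prime⇒1<p pr) 0<n
... | i , m , refl , q∤m , 0<m =
  ∈-cartesianProductWith⁺ (λ i m → q ^ i * m) (∈-upTo⁺ (s≤s i≤E))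
                          (∈-monomials E prs 0<m m≤2^E factors∈′)
  where
  instance
    q^i≢0 : NonZero (q ^ i)
    q^i≢0 = >-nonZero (m^n>0 q {{>-nonZero (<-trans z<s (prime⇒1<p pr))}} i)
  i≤E : i ≤ E
  i≤E = ^-cancelʳ-≤ (s≤s (s≤s z≤n)) (begin
    2 ^ i      ≤⟨ ^-monoˡ-≤ i (prime⇒1<p pr) ⟩
    q ^ i      ≤⟨ m≤m*n (q ^ i) m {{>-nonZero 0<m}} ⟩
    q ^ i * m  ≤⟨ n≤2^E ⟩
    2 ^ E      ∎)
    where open ≤-Reasoning
  m≤2^E : m ≤ 2 ^ E
  m≤2^E = ≤-trans (m≤n*m m (q ^ i)) n≤2^E
  factors∈′ : ∀ {r} → Prime r → r ∣ m → r ∈ qs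
  factors∈′ pr r∣m with factors∈ pr (∣n⇒∣m*n (q ^ i) r∣m)
  ... | here refl  = contradiction r∣m q∤m
  ... | there r∈qs = r∈qs

primesBelow : ℕ → List ℕ
primesBelow N = filter prime? (upTo N)

∑<-onPrime : ∀ X p (g : ℕ → ℕ → ℕ) → ∑[ n < X ] onPrime 0 (g n) p ≡ onPrime 0 (λ q → ∑[ n < X ] g n q) p
∑<-onPrime X p g with prime? p
... | yes _ = refl
... | no  _ = ∑<-zero X

1≤onPrime-𝟙∣ : ∀ {p n} → Prime p → p ∣ n → 1 ≤ onPrime 0 (λ q → 𝟙 (q ∣? n)) p
1≤onPrime-𝟙∣ {p} {n} pr p∣n with prime? p | p ∣? n
... | yes _ | yes _   = ≤-refl
... | yes _ | no  p∤n = contradiction p∣n p∤n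
... | no ¬pr | _      = contradiction pr ¬pr

smooth-or-divisible : ∀ E N d {n} → 0 < n → n ≤ 2 ^ E → 2 ^ E < N + d →
  1 ≤ ∑ₚ (λ p → 𝟙 (p ∣? n)) N d + multiplicity n (monomials E (primesBelow N))
smooth-or-divisible E N d {n} 0<n n≤2^E 2^E<N+d with 1 ≤? ∑ₚ (λ p → 𝟙 (p ∣? n)) N d
... | yes 1≤∑ = ≤-trans 1≤∑ (m≤m+n _ _)
... | no  1≰∑ = ≤-trans (∈⇒1≤multiplicity n∈monomials) (m≤n+m _ _)
  where
  factor<N : ∀ {r} → Prime r → r ∣ n → r < N
  factor<N {r} pr r∣n with r <? N
  ... | yes r<N = r<N
  ... | no  r≮N = contradiction (≤-trans 1≤term (≤-∑< d i<d)) 1≰∑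
    where
    N+i≡r : N + (r ∸ N) ≡ r
    N+i≡r = m+[n∸m]≡n (≮⇒≥ r≮N)
    1≤term : 1 ≤ onPrime 0 (λ p → 𝟙 (p ∣? n)) (N + (r ∸ N))
    1≤term = 1≤onPrime-𝟙∣ (subst Prime (sym N+i≡r) pr) (subst (_∣ n) (sym N+i≡r) r∣n)
    i<d : r ∸ N < d
    i<d = +-cancelˡ-< N (r ∸ N) d (subst (_< N + d) (sym N+i≡r)
            (≤-<-trans (≤-trans (∣⇒≤ {{>-nonZero 0<n}} r∣n) n≤2^E) 2^E<N+d))
  n∈monomials : n ∈ monomials E (primesBelow N)
  n∈monomials = ∈-monomials E (all-filter prime? (upTo N)) 0<n n≤2^E
    (λ pr r∣n → ∈-filter⁺ prime? (∈-upTo⁺ (factor<N pr r∣n)) pr)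

2^E≤∑ₚmultiples+|monomials| : ∀ E N d → 2 ^ E < N + d →
  2 ^ E ≤ ∑ₚ (λ p → multiples p (2 ^ E)) N d + length (monomials E (primesBelow N))
2^E≤∑ₚmultiples+|monomials| E N d 2^E<N+d = begin
  X
    ≡⟨ trans (∑<-const X 1) (*-identityʳ X) ⟨
  ∑[ n < X ] 1
    ≤⟨ ∑<-monoʳ-≤ X (λ n n<X → smooth-or-divisible E N d z<s n<X 2^E<N+d) ⟩
  ∑[ n < X ] (∑ₚ (λ p → 𝟙 (p ∣? suc n)) N d + multiplicity (suc n) G)
    ≡⟨ ∑<-distrib-+ X _ _ ⟩
  ∑[ n < X ] ∑ₚ (λ p → 𝟙 (p ∣? suc n)) N d + ∑[ n < X ] multiplicity (suc n) G
    ≡⟨ cong (_+ ∑[ n < X ] multiplicity (suc n) G) swap ⟩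
  ∑ₚ (λ p → multiples p X) N d + ∑[ n < X ] multiplicity (suc n) G
    ≤⟨ +-monoʳ-≤ _ (∑-multiplicity≤length X G) ⟩
  ∑ₚ (λ p → multiples p X) N d + length G
    ∎
  where
  open ≤-Reasoning
  X = 2 ^ E
  G = monomials E (primesBelow N)
  swap : ∑[ n < X ] ∑ₚ (λ p → 𝟙 (p ∣? suc n)) N d ≡ ∑ₚ (λ p → multiples p X) N d
  swap = trans (∑<-comm X d (λ n i → onPrime 0 (λ p → 𝟙 (p ∣? suc n)) (N + i)))
               (∑<-cong d (λ i → ∑<-onPrime X (N + i) (λ n p → 𝟙 (p ∣? suc n))))

poly<exp : ∀ j → ∃[ E ] (2 * suc E ^ j ≤ 2 ^ E)
poly<exp j = E , (begin
  2 * suc E ^ j       ≡⟨ cong (λ x → 2 * x ^ j) 1+E≡2^c ⟩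
  2 * (2 ^ c) ^ j     ≡⟨ cong (2 *_) (^-*-assoc 2 c j) ⟩
  2 ^ suc (c * j)     ≤⟨ ^-monoʳ-≤ 2 cj<E ⟩
  2 ^ E               ∎)
  where
  open ≤-Reasoning
  s = suc (2 * j)
  c = s + s
  E = 2 ^ c ∸ 1
  1+E≡2^c : suc E ≡ 2 ^ c
  1+E≡2^c = m+[n∸m]≡n (m^n>0 2 c)
  cj<E : suc (c * j) ≤ E
  cj<E = ≤-pred (subst (2 + c * j ≤_) (sym 1+E≡2^c) (begin
    2 + c * j               ≡⟨ regroup s j ⟩
    s * (2 * j) + 2         ≤⟨ +-mono-≤ (*-monoʳ-≤ s (n≤1+n (2 * j))) (s≤s (m≤n+m 1 (2 * j + s))) ⟩
    s * s + (s + s + 1)     ≡⟨ square s ⟩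
    suc s * suc s           ≤⟨ *-mono-≤ (n<b^n ≤-refl s) (n<b^n ≤-refl s) ⟩
    2 ^ s * 2 ^ s           ≡⟨ ^-distribˡ-+-* 2 s s ⟨
    2 ^ c                   ∎))
    where
    regroup : ∀ s j → 2 + (s + s) * j ≡ s * (2 * j) + 2
    regroup = solve-∀
    square : ∀ s → s * s + (s + s + 1) ≡ suc s * suc s
    square = solve-∀

three-halves-block : ∀ N → ∃[ d ] (3 * ∏ₚ id N d ≤ 2 * ∏ₚ suc N d)
three-halves-block N with poly<exp (length (primesBelow N))
... | E , 2[1+E]^π≤2^E = D , *-cancelˡ-≤ X {{>-nonZero (m^n>0 2 E)}} (begin
  X * (3 * A)           ≡⟨ expand X A ⟩
  A * (X + X + X)       ≤⟨ *-monoʳ-≤ A (+-monoʳ-≤ (X + X) X≤2S) ⟩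
  A * (X + X + 2 * S)   ≡⟨ collect A X S ⟩
  2 * (A * (X + S))     ≤⟨ *-monoʳ-≤ 2 (∏ₚ-weierstrass X (λ p → multiples p X) N D p*multiples≤X) ⟩
  2 * (X * Q)           ≡⟨ x∙yz≈y∙xz 2 X Q ⟩
  X * (2 * Q)           ∎)
  where
  open ≤-Reasoning
  X = 2 ^ E
  D = suc X
  A = ∏ₚ id N D
  Q = ∏ₚ suc N D
  S = ∑ₚ (λ p → multiples p X) N D
  G = monomials E (primesBelow N)
  p*multiples≤X : ∀ p → Prime p → p * multiples p X ≤ X
  p*multiples≤X p pr = *-multiples≤ X (<-trans z<s (prime⇒1<p pr))
  2|G|≤X : 2 * length G ≤ X
  2|G|≤X = subst (λ l → 2 * l ≤ X) (sym (length-monomials E (primesBelow N))) 2[1+E]^π≤2^E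
  X≤2S : X ≤ 2 * S
  X≤2S = +-cancelʳ-≤ X X (2 * S) (begin
    X + X                 ≡⟨ cong (λ x → X + x) (+-identityʳ X) ⟨
    2 * X                 ≤⟨ *-monoʳ-≤ 2 (2^E≤∑ₚmultiples+|monomials| E N D (m≤n+m (suc X) N)) ⟩
    2 * (S + length G)    ≡⟨ *-distribˡ-+ 2 S (length G) ⟩
    2 * S + 2 * length G  ≤⟨ +-monoʳ-≤ (2 * S) 2|G|≤X ⟩
    2 * S + X             ∎)
  expand : ∀ x a → x * (3 * a) ≡ a * (x + x + x)
  expand = solve-∀
  collect : ∀ a x s → a * (x + x + 2 * s) ≡ 2 * (a * (x + s))
  collect = solve-∀

doubling-block : ∀ N → ∃[ d ] (2 * ∏ₚ id N d ≤ ∏ₚ suc N d)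
doubling-block N =
  let d₁ , 3A₁≤2Q₁ = three-halves-block N
      d₂ , 3A₂≤2Q₂ = three-halves-block (N + d₁)
      A = ∏ₚ id N (d₁ + d₂)
  in d₁ + d₂ , *-cancelˡ-≤ 4 (begin
       4 * (2 * A)  ≡⟨ *-assoc 4 2 A ⟨
       8 * A        ≤⟨ *-monoˡ-≤ A (n≤1+n 8) ⟩
       9 * A        ≤⟨ ∏ₚ-ratio-+ {3} {2} {3} {2} N d₁ d₂ 3A₁≤2Q₁ 3A₂≤2Q₂ ⟩
       4 * ∏ₚ suc N (d₁ + d₂)  ∎)
  where open ≤-Reasoning

∏ₚ-ratio≥2^r : ∀ r N → ∃[ d ] (2 ^ r * ∏ₚ id N d ≤ ∏ₚ suc N d)
∏ₚ-ratio≥2^r zero    N = 0 , ≤-refl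
∏ₚ-ratio≥2^r (suc r) N =
  let d₁ , 2^rA₁≤Q₁ = ∏ₚ-ratio≥2^r r N
      d₂ , 2A₂≤Q₂   = doubling-block (N + d₁)
  in d₁ + d₂ , (begin
       2 ^ suc r * ∏ₚ id N (d₁ + d₂)  ≡⟨ cong (_* ∏ₚ id N (d₁ + d₂)) (*-comm 2 (2 ^ r)) ⟩
       2 ^ r * 2 * ∏ₚ id N (d₁ + d₂)  ≤⟨ ∏ₚ-ratio-+ {2 ^ r} {1} {2} {1} N d₁ d₂ (≤1* 2^rA₁≤Q₁) (≤1* 2A₂≤Q₂) ⟩
       1 * 1 * ∏ₚ suc N (d₁ + d₂)     ≡⟨ *-identityˡ _ ⟩
       ∏ₚ suc N (d₁ + d₂)             ∎)
  where
  open ≤-Reasoning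
  ≤1* : ∀ {x y} → x ≤ y → x ≤ 1 * y
  ≤1* {y = y} x≤y = ≤-trans x≤y (≤-reflexive (sym (*-identityˡ y)))

primorial : ℕ → ℕ
primorial L = ∏ₚ id 0 L

primes∣primorial : ∀ {p} L → p < L → Prime p → p ∣ primorial L
primes∣primorial {p} (suc L) p<1+L pr with m≤n⇒m<n∨m≡n (≤-pred p<1+L)
... | inj₁ p<L  = ∣m⇒∣m*n (onPrime 1 id L) (primes∣primorial L p<L pr)
... | inj₂ refl with prime? p
...   | yes _  = ∣n⇒∣m*n (primorial p) ∣-refl
...   | no ¬pr = contradiction pr ¬pr

∏ₚsuc≤B^∑ₚδ : ∀ {B} → 1 < B → ∀ N d → ∏ₚ suc N d ≤ B ^ ∑ₚ (δ B) N d
∏ₚsuc≤B^∑ₚδ {B} 1<B N d =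
  ≤-trans (∏<-monoʳ-≤ d (λ i → onPrime-suc≤B^δ (N + i)))
          (≤-reflexive (∏<-^ d B (λ i → onPrime 0 (δ B) (N + i))))
  where
  onPrime-suc≤B^δ : ∀ p → onPrime 1 suc p ≤ B ^ onPrime 0 (δ B) p
  onPrime-suc≤B^δ p with prime? p
  ... | yes pr = n<B^δ 1<B (<-trans z<s (prime⇒1<p pr))
  ... | no  _  = ≤-refl

∏ₚsuc≤∏ₚ² : ∀ N d → ∏ₚ suc N d ≤ ∏ₚ id N d * ∏ₚ id N d
∏ₚsuc≤∏ₚ² N d =
  ≤-trans (∏<-monoʳ-≤ d (λ i → onPrime-suc≤square (N + i))) (≤-reflexive (∏<-distrib-* d _ _))
  where
  onPrime-suc≤square : ∀ p → onPrime 1 suc p ≤ onPrime 1 id p * onPrime 1 id p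
  onPrime-suc≤square p with prime? p
  ... | no  _  = ≤-refl
  ... | yes pr = begin
    suc p    ≤⟨ +-monoˡ-≤ p (<⇒≤ 1<p) ⟩
    p + p    ≡⟨ cong (λ x → p + x) (+-identityʳ p) ⟨
    2 * p    ≤⟨ *-monoˡ-≤ p 1<p ⟩
    p * p    ∎
    where
    open ≤-Reasoning
    1<p = prime⇒1<p pr

*∏ₚ<∏ₚsuc⇒<∏ₚ : ∀ {b} N d → b * ∏ₚ id N d < ∏ₚ suc N d → b < ∏ₚ id N d
*∏ₚ<∏ₚsuc⇒<∏ₚ {b} N d bA<Q =
  *-cancelʳ-< (∏ₚ id N d) b (∏ₚ id N d) (<-≤-trans bA<Q (∏ₚsuc≤∏ₚ² N d))

primorial-δ+K≤φ : ∀ {B} K L → 1 < B → B ^ K * primorial L < ∏ₚ suc 0 L →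
  δ B (primorial L) + K ≤ φ B (primorial L)
primorial-δ+K≤φ {B} K L 1<B B^KP<Q = begin
  δ B P + K        ≤⟨ +-monoˡ-≤ K (δ-least (D ∸ K) 1<B 0<P P<B^[D∸K]) ⟩
  D ∸ K + K        ≡⟨ m∸n+n≡m K≤D ⟩
  D                ≤⟨ ∑ₚδ≤φ B P L 0<P (λ p p<L → primes∣primorial L p<L) ⟩
  φ B P            ∎
  where
  open ≤-Reasoning
  P = primorial L
  D = ∑ₚ (δ B) 0 L
  0<P : 0 < P
  0<P = 1≤∏ₚ 0 L
  B^KP<B^D : B ^ K * P < B ^ D
  B^KP<B^D = <-≤-trans B^KP<Q (∏ₚsuc≤B^∑ₚδ 1<B 0 L)
  K≤D : K ≤ D
  K≤D = ^-cancelʳ-≤ 1<B (≤-trans (m≤m*n (B ^ K) P {{>-nonZero 0<P}}) (<⇒≤ B^KP<B^D))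
  B^D≡B^K*B^[D∸K] : B ^ D ≡ B ^ K * B ^ (D ∸ K)
  B^D≡B^K*B^[D∸K] = trans (cong (B ^_) (sym (m+[n∸m]≡n K≤D))) (^-distribˡ-+-* B K (D ∸ K))
  P<B^[D∸K] : P < B ^ (D ∸ K)
  P<B^[D∸K] = *-cancelˡ-< (B ^ K) P (B ^ (D ∸ K)) (subst (B ^ K * P <_) B^D≡B^K*B^[D∸K] B^KP<B^D)

δ+k≤φ⇒h≤-k : ∀ B n k → δ B n + k ≤ φ B n → h B n ≤ℤ - (+ k)
δ+k≤φ⇒h≤-k B n k δ+k≤φ = begin
  h B n                  ≡⟨ ℤ.m-n≡m⊖n (δ B n) (φ B n) ⟩
  δ B n ⊖ φ B n          ≡⟨ ℤ.⊖-≤ (m+n≤o⇒m≤o (δ B n) δ+k≤φ) ⟩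
  - (+ (φ B n ∸ δ B n))  ≤⟨ ℤ.neg-mono-≤ (+≤+ k≤φ∸δ) ⟩
  - (+ k)                ∎
  where
  open ℤ.≤-Reasoning
  k≤φ∸δ : k ≤ φ B n ∸ δ B n
  k≤φ∸δ = m+n≤o⇒m≤o∸n k (subst (_≤ φ B n) (+-comm (δ B n) k) δ+k≤φ)

primorial-ratio>B^K : ∀ {B} → 1 < B → ∀ K → ∃[ L ] (B ^ K * primorial L < ∏ₚ suc 0 L)
primorial-ratio>B^K {B} 1<B K =
  let L , 2^[B^K]P≤Q = ∏ₚ-ratio≥2^r (B ^ K) 0
      B^K<2^[B^K] = n<b^n ≤-refl (B ^ K)
  in L , <-≤-trans (*-monoˡ-< (primorial L) {{>-nonZero (1≤∏ₚ 0 L)}} B^K<2^[B^K]) 2^[B^K]P≤Q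

proposition5 : (B : ℕ) → 2 ≤ B → (k : ℕ) → 0 < k →
    (m : ℕ) → ∃[ n ] (m < n × h B n ≤ℤ - (+ k))
proposition5 B 1<B k _ m =
  let K = k + m
      L , B^KP<Q = primorial-ratio>B^K 1<B K
      P = primorial L
  in P , (begin-strict
           m      ≤⟨ m≤n+m m k ⟩
           K      <⟨ n<b^n 1<B K ⟩
           B ^ K  <⟨ *∏ₚ<∏ₚsuc⇒<∏ₚ 0 L B^KP<Q ⟩
           P      ∎)
       , δ+k≤φ⇒h≤-k B P k (≤-trans (+-monoʳ-≤ (δ B P) (m≤m+n k m)) (primorial-δ+K≤φ K L 1<B B^KP<Q))
  where open ≤-Reasoning
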